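{- $R(4,7)\ge 49$. Equivalently, there exists a two-coloring of the edges of the complete graph $K_{48}$ such that there is no complete subgraph on 4 vertices all of whose edges have the first color, and no complete subgraph on 7 vertices all of whose edges have the second color.
   Context: For positive integers $s,t$, the classical Ramsey number $R(s,t)$ is the smallest integer $n$ such that every two-coloring of the edges of the complete graph $K_n$ contains a copy of $K_s$ all of whose edges have the first color or a copy of $K_t$ all of whose edges have the second color. -}

module Defs where

open import Data.Nat using (ℕ)
open import Data.Fin using (Fin)
open import Data.Bool using (Bool; true; false)
open import Data.Product using (Σ; _×_)
open import Relation.Binary.PropositionalEquality using (_≡_; _≢_)
open import Relation.Nullary using (¬_)
open import Function.Definitions using (Injective)

-- A two-coloring of the edges of K_n: a symmetric function on pairs of
-- vertices (values on the diagonal are irrelevant: they are never used).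
-- Colour true = first colour, false = second colour.
record TwoColoring (n : ℕ) : Set where
  field
    colour : Fin n → Fin n → Bool
    symmetric : ∀ u v → colour u v ≡ colour v u
open TwoColoring public

MonoClique : {n : ℕ} → TwoColoring n → Bool → ℕ → Set
MonoClique {n} χ c k =
  Σ (Fin k → Fin n) λ f →
    Injective _≡_ _≡_ f × (∀ i j → i ≢ j → colour χ (f i) (f j) ≡ c)

-- A k-clique inside xs is found by branching on the head v: either it uses v,
-- and the rest is a (k-1)-clique among the neighbours of v in the tail, or it
-- lives entirely in the tail.  This gives a sound Boolean test for
-- clique-freeness, and the theorem follows by evaluating it on an explicit
-- colouring of K₄₈ for both colours.

module Submission where

open import Defs
open import Data.Bool using (true; false)
open import Data.Product using (Σ; _×_)
open import Relation.Nullary using (¬_)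

open import Data.Bool using (Bool; T; _∧_)
import Data.Bool.Properties as Bool
open import Data.Empty using (⊥-elim)
open import Data.Fin using (Fin; zero; suc; toℕ; punchIn)
import Data.Fin.Properties as Fin
open import Data.List using (List; []; _∷_; filter; allFin)
open import Data.List.Membership.Propositional using (_∈_)
open import Data.List.Membership.Propositional.Properties using (∈-filter⁺; ∈-allFin)
open import Data.List.Relation.Unary.Any using (here; there)
open import Data.Nat using (ℕ; zero; suc; _/_; _%_; _≡ᵇ_)
open import Data.Product using (_,_; proj₁; proj₂)
open import Data.Sum using (_⊎_; inj₁; inj₂; [_,_])
open import Data.Vec using (Vec; lookup)
import Data.Vec as Vec
open import Function using (Equivalence; _∘_; _∘′_)
open import Function.Definitions using (Injective)
open import Level using (Level)
open import Relation.Binary.Core using (Rel)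
open import Relation.Binary.Definitions using (Decidable; DecidableEquality)
open import Relation.Binary.PropositionalEquality using (_≡_; _≢_; sym; trans; subst)
open import Relation.Nullary using (yes; no)
open import Relation.Nullary.Decidable using (toWitness)

module Cliques {A : Set} (_≟_ : DecidableEquality A)
               {ℓ : Level} {_~_ : Rel A ℓ} (_~?_ : Decidable _~_) where

  CliqueIn : ℕ → List A → Set ℓ
  CliqueIn k xs = Σ (Fin k → A) λ f →
    Injective _≡_ _≡_ f × (∀ i → f i ∈ xs) × (∀ i j → i ≢ j → f i ~ f j)

  neighbours : A → List A → List A
  neighbours v = filter (v ~?_)

  cliqueFreeᵇ : ℕ → List A → Bool
  cliqueFreeᵇ zero    _        = false
  cliqueFreeᵇ (suc k) []       = true
  cliqueFreeᵇ (suc k) (v ∷ vs) = cliqueFreeᵇ k (neighbours v vs) ∧ cliqueFreeᵇ (suc k) vs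

  cliqueIn-through : ∀ {k v vs} ((f , _) : CliqueIn (suc k) (v ∷ vs)) →
                     ∀ i → f i ≡ v → CliqueIn k (neighbours v vs)
  cliqueIn-through {v = v} {vs} (f , inj , mem , adj) i fi≡v = g , g-inj , g-mem , g-adj
    where
    g : Fin _ → A
    g j = f (punchIn i j)

    g-inj : Injective _≡_ _≡_ g
    g-inj {a} {b} = Fin.punchIn-injective i a b ∘′ inj

    g-mem : ∀ j → g j ∈ neighbours v vs
    g-mem j with mem (punchIn i j)
    ... | here gj≡v = ⊥-elim (Fin.punchInᵢ≢i i j (inj (trans gj≡v (sym fi≡v))))
    ... | there gj∈vs = ∈-filter⁺ (v ~?_) gj∈vs
      (subst (_~ g j) fi≡v (adj i (punchIn i j) (Fin.punchInᵢ≢i i j ∘ sym)))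

    g-adj : ∀ a b → a ≢ b → g a ~ g b
    g-adj a b a≢b = adj (punchIn i a) (punchIn i b) (a≢b ∘ Fin.punchIn-injective i a b)

  cliqueIn-avoiding : ∀ {k v vs} ((f , _) : CliqueIn k (v ∷ vs)) →
                      (∀ i → f i ≢ v) → CliqueIn k vs
  cliqueIn-avoiding (f , inj , mem , adj) f≢v = f , inj , mem′ , adj
    where
    mem′ : ∀ i → f i ∈ _
    mem′ i with mem i
    ... | here fi≡v  = ⊥-elim (f≢v i fi≡v)
    ... | there fi∈vs = fi∈vs

  cliqueIn-∷⁻ : ∀ {k v vs} → CliqueIn (suc k) (v ∷ vs) →
                CliqueIn k (neighbours v vs) ⊎ CliqueIn (suc k) vs
  cliqueIn-∷⁻ {v = v} c@(f , _) with Fin.any? (λ i → f i ≟ v)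
  ... | yes (i , fi≡v) = inj₁ (cliqueIn-through c i fi≡v)
  ... | no ∄i          = inj₂ (cliqueIn-avoiding c (λ i fi≡v → ∄i (i , fi≡v)))

  cliqueFreeᵇ-sound : ∀ k xs → T (cliqueFreeᵇ k xs) → ¬ CliqueIn k xs
  cliqueFreeᵇ-sound (suc k) []       _    (_ , _ , mem , _) with mem zero
  ... | ()
  cliqueFreeᵇ-sound (suc k) (v ∷ vs) free =
    [ cliqueFreeᵇ-sound k (neighbours v vs) (proj₁ split)
    , cliqueFreeᵇ-sound (suc k) vs (proj₂ split) ] ∘ cliqueIn-∷⁻
    where
    split : T (cliqueFreeᵇ k (neighbours v vs)) × T (cliqueFreeᵇ (suc k) vs)
    split = Equivalence.to Bool.T-∧ free

noMonoClique : ∀ {n} (χ : TwoColoring n) c k →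
               let open Cliques Fin._≟_ (λ u v → colour χ u v Bool.≟ c) in
               T (cliqueFreeᵇ k (allFin n)) → ¬ MonoClique χ c k
noMonoClique χ c k free (f , inj , adj) =
  cliqueFreeᵇ-sound k _ free (f , inj , (λ i → ∈-allFin (f i)) , adj)
  where open Cliques Fin._≟_ (λ u v → colour χ u v Bool.≟ c)

testBit : ℕ → ℕ → Bool
testBit m zero    = m % 2 ≡ᵇ 1
testBit m (suc i) = testBit (m / 2) i

-- Row u as a bitmask: bit v is set iff the edge uv has the first colour.
rows : Vec ℕ 48
rows = Vec.fromList
  ( 220816080262690 ∷ 160157183814725 ∷ 38839390918810 ∷ 77678781837620
  ∷ 155357563675180 ∷ 29240150639705 ∷ 58480301279394 ∷ 116960602559300
  ∷ 233921205118600 ∷ 186367433524625 ∷ 91259890338595 ∷ 182519780676678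
  ∷ 83564584659085 ∷ 167129169318170 ∷ 52783361864245 ∷ 105566723728490
  ∷ 211133447440596 ∷ 140791918694825 ∷ 108860678995 ∷ 217719391910
  ∷ 435438783820 ∷ 870885431960 ∷ 1741770863920 ∷ 3483543824992
  ∷ 6967020541120 ∷ 13934041082240 ∷ 27868065387264 ∷ 55736667645440
  ∷ 111473335290880 ∷ 222944657315840 ∷ 164414337921025 ∷ 47361752195075
  ∷ 94723504390150 ∷ 189414796525580 ∷ 97354616340505 ∷ 194700642746418
  ∷ 108201186689125 ∷ 216402373378250 ∷ 150298977894805 ∷ 19122979078955
  ∷ 37971080250966 ∷ 84738253524140 ∷ 169476507048280 ∷ 24492688552625
  ∷ 48985377105250 ∷ 229912149543620 ∷ 178349322376585 ∷ 110408040131347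
  ∷ [])

rowColour : Fin 48 → Fin 48 → Bool
rowColour u v = testBit (lookup rows u) (toℕ v)

rowColour-symmetric : ∀ u v → rowColour u v ≡ rowColour v u
rowColour-symmetric = toWitness {a? = Fin.all? λ u → Fin.all? λ v → rowColour u v Bool.≟ rowColour v u} _

χ₄₈ : TwoColoring 48
χ₄₈ = record { colour = rowColour ; symmetric = rowColour-symmetric }

mainTheorem2 : Σ (TwoColoring 48) λ χ → ¬ MonoClique χ true 4 × ¬ MonoClique χ false 7
mainTheorem2 = χ₄₈ , noMonoClique χ₄₈ true 4 _ , noMonoClique χ₄₈ false 7 _
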